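{- Let $K(A,B)$ be a complete bipartite graph whose edges are colored blue and green. Then $K(A,B)$ is an $S_1$-type graph if and only if the vertices of $K(A,B)$ cannot be covered by fewer than three vertex-disjoint monochromatic trees (i.e., every covering of the vertex set by vertex-disjoint monochromatic trees uses at least three trees).
   Context: $K(A,B)$ is the complete bipartite graph with nonempty partite sets $A,B$, edges colored blue or green. A monochromatic tree is a tree all of whose edges have the same color; a single vertex counts as one. Let $X$ be the set of vertices all of whose incident edges are blue and $Y$ the set of vertices all of whose incident edges are green. $K(A,B)$ is $S$-type if $X\neq\emptyset$ and $Y\neq\emptyset$; then $X\cup Y$ lies within a single partite set. If $X\cup Y\subseteq A$, write $A_1=X$, $A_3=Y$, $A_2=A\setminus(A_1\cup A_3)$, and for each nonempty proper subset $B'\subsetneq B$ let $b(B')$ be the set of $x\in A_2$ such that all edges from $x$ to $B'$ are blue and all edges from $x$ to $B\setminus B'$ are green. $K(A,B)$ (with $X\cup Y\subseteq A$) is $S_1^*$-type if it is $S$-type, $|B|=1$, $|A_1|\geq 2$ and $|A_3|\geq 2$; it is $S_1'$-type if it is $S$-type, $|B|\geq 2$, $|A_1|\geq 2$, $|A_3|\geq 2$, and $b(B')\neq\emptyset$ for every nonempty proper subset $B'$ of $B$. The analogous definitions apply with the roles of $A$ and $B$ exchanged when $X\cup Y\subseteq B$. $K(A,B)$ is $S_1$-type if it is $S_1^*$-type or $S_1'$-type. -}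

module Defs where

open import Data.Nat using (ℕ; suc; _+_; _≤_)
open import Data.Fin using (Fin; _≟_)
open import Data.Fin.Subset using (Subset; _∈_; _∉_)
open import Data.Fin.Subset using (Nonempty) public
open import Data.List using (List; length; filter; map; _++_; allFin)
open import Data.List.Relation.Unary.Unique.Propositional using (Unique)
import Data.List.Membership.Propositional as LM
open import Data.Product using (Σ; ∃; _×_; _,_)
open import Data.Sum using (_⊎_; inj₁; inj₂)
open import Relation.Binary.PropositionalEquality using (_≡_; _≢_)
open import Relation.Nullary using (¬_)

-- The complete bipartite graph K(A,B) with A = Fin a, B = Fin b.

data Colour : Set where
  blue green : Colour

Colouring : ℕ → ℕ → Set
Colouring a b = Fin a → Fin b → Colour

Vertex : ℕ → ℕ → Set
Vertex a b = Fin a ⊎ Fin b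

Edge : ℕ → ℕ → Set
Edge a b = Fin a × Fin b

transpose : ∀ {a b} → Colouring a b → Colouring b a
transpose c j i = c i j

allVertices : ∀ a b → List (Vertex a b)
allVertices a b = map inj₁ (allFin a) ++ map inj₂ (allFin b)

data Walk {a b} (E : List (Edge a b)) : Vertex a b → Vertex a b → Set where
  here  : ∀ {v} → Walk E v v
  stepAB : ∀ {i j v} → (i , j) LM.∈ E → Walk E (inj₂ j) v → Walk E (inj₁ i) v
  stepBA : ∀ {i j v} → (i , j) LM.∈ E → Walk E (inj₁ i) v → Walk E (inj₂ j) v

-- Tree t has vertex set {v | part v ≡ t} (so the trees are vertex
-- disjoint and cover all vertices), colour colour t and edge set
-- edges t (a duplicate-free list of edges of K(A,B)).  Each tree is a
-- connected graph on its vertex set with |E| = |V| - 1 edges, all of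
-- its colour (i.e. a tree, in particular with at least one vertex).
record Cover {a b} (c : Colouring a b) (k : ℕ) : Set where
  field
    part      : Vertex a b → Fin k
    colour    : Fin k → Colour
    edges     : Fin k → List (Edge a b)
    unique    : ∀ t → Unique (edges t)
    edgesIn   : ∀ t {i j} → (i , j) LM.∈ edges t →
                  part (inj₁ i) ≡ t × part (inj₂ j) ≡ t × c i j ≡ colour t
    size      : ∀ t → length (edges t) + 1
                      ≡ length (filter (λ v → part v ≟ t) (allVertices a b))
    connected : ∀ t u v → part u ≡ t → part v ≡ t → Walk (edges t) u v

monoA : ∀ {a b} → Colouring a b → Colour → Fin a → Set
monoA c col i = ∀ j → c i j ≡ col

monoB : ∀ {a b} → Colouring a b → Colour → Fin b → Set
monoB c col j = ∀ i → c i j ≡ col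

-- S-type: X ≠ ∅ and Y ≠ ∅
SType : ∀ {a b} → Colouring a b → Set
SType {a} {b} c =
  ((Σ (Fin a) (monoA c blue)) ⊎ (Σ (Fin b) (monoB c blue))) ×
  ((Σ (Fin a) (monoA c green)) ⊎ (Σ (Fin b) (monoB c green)))

XY⊆A : ∀ {a b} → Colouring a b → Set
XY⊆A {a} {b} c = ∀ (j : Fin b) → ¬ monoB c blue j × ¬ monoB c green j

atLeastTwo : ∀ {a} → (Fin a → Set) → Set
atLeastTwo {a} P = Σ (Fin a) λ x → Σ (Fin a) λ y → x ≢ y × P x × P y

-- x ∈ b(B') : x ∈ A₂ and x is blue to B', green to B ∖ B'
inbB' : ∀ {a b} → Colouring a b → Subset b → Fin a → Set
inbB' {a} {b} c B' x =
  ¬ monoA c blue x × ¬ monoA c green x ×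
  (∀ (j : Fin b) → (j ∈ B' → c x j ≡ blue) × (j ∉ B' → c x j ≡ green))

Proper : ∀ {b} → Subset b → Set
Proper {b} B' = Σ (Fin b) λ j → j ∉ B'

S1*A : ∀ {a b} → Colouring a b → Set
S1*A {a} {b} c = SType c × XY⊆A c × b ≡ 1 ×
  atLeastTwo (monoA c blue) × atLeastTwo (monoA c green)

S1'A : ∀ {a b} → Colouring a b → Set
S1'A {a} {b} c = SType c × XY⊆A c × 2 ≤ b ×
  atLeastTwo (monoA c blue) × atLeastTwo (monoA c green) ×
  (∀ (B' : Subset b) → Nonempty B' → Proper B' → Σ (Fin a) (inbB' c B'))

S1A : ∀ {a b} → Colouring a b → Set
S1A c = S1*A c ⊎ S1'A c

S1 : ∀ {a b} → Colouring a b → Set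
S1 c = S1A c ⊎ S1A (transpose c)

module Submission where

-- Lower bound (S1A-needs-three): a blue-mono and a green-mono vertex never
-- share a tree; with two trees, B meets both (so |B| ≠ 1), and no vertex of
-- b(B ∩ green tree) can exist.  Upper bound (S1-from-needs-three): if some
-- colour has no mono vertex, the component of the other colour yields at
-- most two trees; otherwise X ∪ Y lies in one side, and each failing S₁
-- condition yields an explicit cover by two double stars.

open import Defs
open import Data.Bool using (Bool; true; false; not; if_then_else_)
open import Data.Bool.Properties using (not-injective; ¬-not)
import Data.Bool as Bool
open import Data.Nat using (ℕ; zero; suc; _≤_; _<_; _+_; z≤n; s≤s)
import Data.Nat as Nat
open import Data.Nat.Properties using (n≢0⇒n>0; ≤-pred; ≤-trans; ≤-refl; n≤0⇒n≡0; suc-injective; <-trans; <-irrefl; <-≤-trans; ≤-<-trans; n<1+n; +-comm; m≤n⇒m≤1+n)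
open import Data.Fin using (Fin; zero; suc)
import Data.Fin as F
open import Data.Fin.Properties using (any?; all?; ¬∀⟶∃¬)
open import Data.Sum using (_⊎_; inj₁; inj₂)
open import Data.Sum.Properties using (≡-dec; inj₁-injective; inj₂-injective; swap-involutive)
import Data.Sum as Sum
import Data.Product as Prod
open import Data.Product using (Σ; ∃; _×_; _,_; proj₁; proj₂)
open import Data.Product.Properties using (,-injectiveˡ; ,-injectiveʳ)
open import Data.List using (List; []; _∷_; length; filter; map; _++_; allFin)
open import Data.Vec using (tabulate)
open import Data.Vec.Properties using (lookup∘tabulate; []=⇒lookup; lookup⇒[]=)
open import Data.Fin.Subset.Properties using (_∈?_)
open import Data.Fin.Subset using (Subset) renaming (_∈_ to _∈ₛ_; _∉_ to _∉ₛ_)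
open import Data.List.Properties using (length-map; length-++; filter-++)
open import Data.List.Membership.Propositional using (_∈_)
open import Data.List.Membership.Propositional.Properties
  using (∈-map⁺; ∈-map⁻; ∈-filter⁺; ∈-filter⁻; ∈-++⁺ˡ; ∈-++⁺ʳ; ∈-allFin)
open import Data.List.Relation.Unary.Any using (here; there)
open import Data.List.Relation.Unary.All as All using (All; []; _∷_)
import Data.List.Relation.Unary.All.Properties as AllP
open import Data.List.Relation.Unary.AllPairs using ([]; _∷_)
open import Data.List.Relation.Unary.Unique.Propositional using (Unique)
import Data.List.Relation.Unary.Unique.Propositional.Properties as UniqueP
open import Relation.Binary.PropositionalEquality using (_≡_; _≢_; refl; sym; trans; cong; cong₂; subst; subst₂; module ≡-Reasoning)
open import Relation.Binary.Definitions using (DecidableEquality)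
open import Relation.Nullary using (¬_; Dec; yes; no; ¬?; does)
open import Relation.Nullary.Decidable using (_×-dec_; _→-dec_; _⊎-dec_; dec-true; dec-false)
open import Relation.Unary using (Decidable)
open import Function.Bundles using (_⇔_; mk⇔)
open import Data.Empty using (⊥; ⊥-elim)

_≟C_ : DecidableEquality Colour
blue  ≟C blue  = yes refl
blue  ≟C green = no λ ()
green ≟C blue  = no λ ()
green ≟C green = yes refl

flip : Colour → Colour
flip blue  = green
flip green = blue

other-colour : ∀ {col x} → x ≢ col → x ≡ flip col
other-colour {blue}  {blue}  x≢ = ⊥-elim (x≢ refl)
other-colour {blue}  {green} _  = refl
other-colour {green} {blue}  _  = refl
other-colour {green} {green} x≢ = ⊥-elim (x≢ refl)

blue≢green : blue ≢ green
blue≢green ()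

flip-≢ : ∀ col → col ≢ flip col
flip-≢ blue  ()
flip-≢ green ()

choose : ∀ {k} {P : Fin (suc k) → Set} → Decidable P → Fin (suc k)
choose P? with any? P?
... | yes (x , _) = x
... | no _        = zero

choose-spec : ∀ {k} {P : Fin (suc k) → Set} (P? : Decidable P) → ∃ P → P (choose P?)
choose-spec P? ex with any? P?
... | yes (_ , px) = px
... | no ¬ex       = ⊥-elim (¬ex ex)

update : {X Y : Set} → DecidableEquality X → X → Y → (X → Y) → X → Y
update _≟_ x y f x' = if does (x' ≟ x) then y else f x'

update-hit : {X Y : Set} (_≟_ : DecidableEquality X) (x : X) (y : Y) (f : X → Y) →
             update _≟_ x y f x ≡ y
update-hit _≟_ x y f rewrite dec-true (x ≟ x) refl = refl

update-miss : {X Y : Set} (_≟_ : DecidableEquality X) {x x' : X} (y : Y) (f : X → Y) →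
              x' ≢ x → update _≟_ x y f x' ≡ f x'
update-miss _≟_ {x} {x'} y f x'≢x rewrite dec-false (x' ≟ x) x'≢x = refl

_≟V_ : ∀ {a b} → DecidableEquality (Vertex a b)
_≟V_ = ≡-dec F._≟_ F._≟_

∈-allVertices : ∀ {a b} (v : Vertex a b) → v ∈ allVertices a b
∈-allVertices {a} (inj₁ i) = ∈-++⁺ˡ (∈-map⁺ inj₁ (∈-allFin i))
∈-allVertices {a} (inj₂ j) = ∈-++⁺ʳ (map inj₁ (allFin a)) (∈-map⁺ inj₂ (∈-allFin j))

allVertices-unique : ∀ {a b} → Unique (allVertices a b)
allVertices-unique {a} {b} =
  UniqueP.++⁺ (UniqueP.map⁺ inj₁-injective (UniqueP.allFin⁺ a))
              (UniqueP.map⁺ inj₂-injective (UniqueP.allFin⁺ b)) disjoint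
  where
  disjoint : ∀ {v} → ¬ (v ∈ map inj₁ (allFin a) × v ∈ map inj₂ (allFin b))
  disjoint (p , q) with ∈-map⁻ inj₁ p | ∈-map⁻ inj₂ q
  ... | _ , _ , refl | _ , _ , ()

unique-map : ∀ {A B : Set} (f : A → B) {xs : List A} →
             (∀ {x y} → x ∈ xs → y ∈ xs → f x ≡ f y → x ≡ y) → Unique xs → Unique (map f xs)
unique-map f {[]}     _   []         = []
unique-map f {x ∷ xs} inj (x∉ ∷ xs!) =
  AllP.map⁺ (All.tabulate (λ y∈ fx≡fy → All.lookup x∉ y∈ (inj (here refl) (there y∈) fx≡fy)))
  ∷ unique-map f (λ p q → inj (there p) (there q)) xs!

module _ {A : Set} {P : A → Set} (P? : Decidable P) (_≟_ : DecidableEquality A) where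

  except : (r : A) → Decidable (λ x → P x × x ≢ r)
  except r x = P? x ×-dec ¬? (x ≟ r)

  private
    length-except-absent : ∀ r (xs : List A) → All (r ≢_) xs →
                           length (filter (except r) xs) ≡ length (filter P? xs)
    length-except-absent r []       _            = refl
    length-except-absent r (x ∷ xs) (r≢x ∷ r∉xs) with P? x | x ≟ r
    ... | yes _ | no _     = cong suc (length-except-absent r xs r∉xs)
    ... | no _  | _        = length-except-absent r xs r∉xs
    ... | yes _ | yes x≡r  = ⊥-elim (r≢x (sym x≡r))

  length-except : ∀ r (xs : List A) → Unique xs → r ∈ xs → P r →
                  length (filter (except r) xs) + 1 ≡ length (filter P? xs)
  length-except r (r ∷ xs) (r∉xs ∷ _) (here refl) pr with P? r | r ≟ r
  ... | yes _  | yes _ = trans (+-comm _ 1) (cong suc (length-except-absent r xs r∉xs))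
  ... | yes _  | no r≢r = ⊥-elim (r≢r refl)
  ... | no ¬pr | _      = ⊥-elim (¬pr pr)
  length-except r (x ∷ xs) (x∉xs ∷ xs!) (there r∈xs) pr with P? x | x ≟ r
  ... | yes _ | no _    = cong suc (length-except r xs xs! r∈xs pr)
  ... | no _  | _       = length-except r xs xs! r∈xs pr
  ... | yes _ | yes x≡r = ⊥-elim (All.lookup x∉xs r∈xs x≡r)

true≢false : true ≢ false
true≢false ()

distinct : ∀ {x y} → x ≡ true → y ≡ false → x ≢ y
distinct x≡true y≡false x≡y = true≢false (trans (sym x≡true) (trans x≡y y≡false))

distinct′ : ∀ {x y} → x ≡ false → y ≡ true → x ≢ y
distinct′ x≡false y≡true x≡y = distinct y≡true x≡false (sym x≡y)

does-true : ∀ {A : Set} (d : Dec A) → does d ≡ true → A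
does-true (yes a) _ = a

does-false : ∀ {A : Set} (d : Dec A) → does d ≡ false → ¬ A
does-false (no ¬a) _ = ¬a

falses : {A : Set} → (A → Bool) → List A → ℕ
falses f []       = 0
falses f (x ∷ xs) = if f x then falses f xs else suc (falses f xs)

module _ {A : Set} (f g : A → Bool) (f⊆g : ∀ v → f v ≡ true → g v ≡ true) where

  falses-mono : ∀ xs → falses g xs ≤ falses f xs
  falses-mono [] = z≤n
  falses-mono (x ∷ xs) with f x in fx | g x in gx
  ... | true  | true  = falses-mono xs
  ... | true  | false = ⊥-elim (true≢false (trans (sym (f⊆g x fx)) gx))
  ... | false | true  = m≤n⇒m≤1+n (falses-mono xs)
  ... | false | false = s≤s (falses-mono xs)

  falses-strict : ∀ {w} xs → f w ≡ false → g w ≡ true → w ∈ xs → falses g xs < falses f xs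
  falses-strict (x ∷ xs) fw gw (here refl) rewrite fw | gw = s≤s (falses-mono xs)
  falses-strict (x ∷ xs) fw gw (there w∈) with f x in fx | g x in gx
  ... | true  | true  = falses-strict xs fw gw w∈
  ... | true  | false = ⊥-elim (true≢false (trans (sym (f⊆g x fx)) gx))
  ... | false | true  = ≤-<-trans (falses-mono xs) (n<1+n _)
  ... | false | false = s≤s (falses-strict xs fw gw w∈)

falses-zero : {A : Set} (f : A → Bool) (xs : List A) → falses f xs ≡ 0 → ∀ {v} → v ∈ xs → f v ≡ true
falses-zero f (x ∷ xs) none v∈ with f x in fx
falses-zero f (x ∷ xs) none (here refl) | true = fx
falses-zero f (x ∷ xs) none (there v∈) | true = falses-zero f xs none v∈

module _ {a b} {E : List (Edge a b)} where

  _++W_ : ∀ {u v w} → Walk E u v → Walk E v w → Walk E u w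
  here       ++W q = q
  stepAB e p ++W q = stepAB e (p ++W q)
  stepBA e p ++W q = stepBA e (p ++W q)

  reverseW : ∀ {u v} → Walk E u v → Walk E v u
  reverseW here         = here
  reverseW (stepAB e p) = reverseW p ++W stepBA e here
  reverseW (stepBA e p) = reverseW p ++W stepAB e here

module _ {a b} (c : Colouring a b) where

  -- A rooted spanning tree of colour col on the vertex set P, presented by
  -- parent pointers: every non-root vertex of P is joined by an edge of
  -- colour col to its parent, which lies in P and has strictly smaller rank.
  record RootedTree (P : Vertex a b → Set) (col : Colour) : Set where
    field
      root       : Vertex a b
      root∈      : P root
      parentA    : Fin a → Fin b
      parentB    : Fin b → Fin a
      rank       : Vertex a b → ℕ
      parentA-ok : ∀ i → P (inj₁ i) → inj₁ i ≢ root →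
                   P (inj₂ (parentA i)) × c i (parentA i) ≡ col × rank (inj₂ (parentA i)) < rank (inj₁ i)
      parentB-ok : ∀ j → P (inj₂ j) → inj₂ j ≢ root →
                   P (inj₁ (parentB j)) × c (parentB j) j ≡ col × rank (inj₁ (parentB j)) < rank (inj₂ j)

  retarget : ∀ {P P' : Vertex a b → Set} {col} →
             (∀ v → P v → P' v) → (∀ v → P' v → P v) → RootedTree P col → RootedTree P' col
  retarget to from T = record
    { root = root ; root∈ = to _ root∈ ; parentA = parentA ; parentB = parentB ; rank = rank
    ; parentA-ok = λ i p ne → let (q , col , lt) = parentA-ok i (from _ p) ne in to _ q , col , lt
    ; parentB-ok = λ j p ne → let (q , col , lt) = parentB-ok j (from _ p) ne in to _ q , col , lt }
    where open RootedTree T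

  -- A partition of the vertices into k parts, each carrying a rooted tree
  -- of its colour, is a cover by k vertex-disjoint monochromatic trees: the
  -- edges of a part are the edges from its non-root vertices to their parents.
  module TreesToCover {k} (part : Vertex a b → Fin k) (colour : Fin k → Colour)
                      (T : ∀ t → RootedTree (λ v → part v ≡ t) (colour t)) where
    open RootedTree

    parentEdge : Fin k → Vertex a b → Edge a b
    parentEdge t (inj₁ i) = i , parentA (T t) i
    parentEdge t (inj₂ j) = parentB (T t) j , j

    inPart : (t : Fin k) → Decidable (λ v → part v ≡ t)
    inPart t v = part v F.≟ t

    nonRoots : Fin k → List (Vertex a b)
    nonRoots t = filter (except (inPart t) _≟V_ (root (T t))) (allVertices a b)

    treeEdges : Fin k → List (Edge a b)
    treeEdges t = map (parentEdge t) (nonRoots t)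

    ∈-nonRoots⁻ : ∀ {t v} → v ∈ nonRoots t → part v ≡ t × v ≢ root (T t)
    ∈-nonRoots⁻ {t} p = proj₂ (∈-filter⁻ (except (inPart t) _≟V_ (root (T t))) {xs = allVertices a b} p)

    ∈-nonRoots⁺ : ∀ {t v} → part v ≡ t → v ≢ root (T t) → v ∈ nonRoots t
    ∈-nonRoots⁺ {t} {v} pv ne = ∈-filter⁺ (except (inPart t) _≟V_ (root (T t))) (∈-allVertices v) (pv , ne)

    -- Ranks decrease along parent pointers, so an A-vertex and a B-vertex
    -- of the same part cannot be each other's parents.
    no-2-cycle : ∀ t {i j} → inj₁ i ∈ nonRoots t → inj₂ j ∈ nonRoots t →
                 parentA (T t) i ≡ j → parentB (T t) j ≡ i → ⊥
    no-2-cycle t {i} i∈ j∈ refl ji = <-irrefl refl (<-trans i→j j→i)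
      where
      i→j : rank (T t) (inj₂ (parentA (T t) i)) < rank (T t) (inj₁ i)
      i→j = proj₂ (proj₂ (parentA-ok (T t) i (proj₁ (∈-nonRoots⁻ i∈)) (proj₂ (∈-nonRoots⁻ i∈))))
      j→i : rank (T t) (inj₁ i) < rank (T t) (inj₂ (parentA (T t) i))
      j→i = subst (λ z → rank (T t) (inj₁ z) < rank (T t) (inj₂ (parentA (T t) i))) ji
              (proj₂ (proj₂ (parentB-ok (T t) _ (proj₁ (∈-nonRoots⁻ j∈)) (proj₂ (∈-nonRoots⁻ j∈)))))

    parentEdge-injective : ∀ t {x y} → x ∈ nonRoots t → y ∈ nonRoots t → parentEdge t x ≡ parentEdge t y → x ≡ y
    parentEdge-injective t {inj₁ i} {inj₁ _} _  _  e = cong inj₁ (,-injectiveˡ e)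
    parentEdge-injective t {inj₂ j} {inj₂ _} _  _  e = cong inj₂ (,-injectiveʳ e)
    parentEdge-injective t {inj₁ i} {inj₂ j} x∈ y∈ e =
      ⊥-elim (no-2-cycle t x∈ y∈ (,-injectiveʳ e) (sym (,-injectiveˡ e)))
    parentEdge-injective t {inj₂ j} {inj₁ i} x∈ y∈ e =
      ⊥-elim (no-2-cycle t y∈ x∈ (sym (,-injectiveʳ e)) (,-injectiveˡ e))

    treeEdges-in : ∀ t {i j} → (i , j) ∈ treeEdges t →
                   part (inj₁ i) ≡ t × part (inj₂ j) ≡ t × c i j ≡ colour t
    treeEdges-in t e∈ with ∈-map⁻ (parentEdge t) e∈
    ... | inj₁ i , i∈ , refl = let (pi , ne) = ∈-nonRoots⁻ i∈ ; (pj , col , _) = parentA-ok (T t) i pi ne in pi , pj , col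
    ... | inj₂ j , j∈ , refl = let (pj , ne) = ∈-nonRoots⁻ j∈ ; (pi , col , _) = parentB-ok (T t) j pj ne in pi , pj , col

    walkToRoot : ∀ t (fuel : ℕ) u → rank (T t) u < fuel → part u ≡ t → Walk (treeEdges t) u (root (T t))
    walkToRoot t (suc fuel) u (s≤s lt) pu with u ≟V root (T t)
    ... | yes refl = here
    walkToRoot t (suc fuel) (inj₁ i) (s≤s lt) pu | no ne =
      let (pj , _ , ranks) = parentA-ok (T t) i pu ne in
      stepAB (∈-map⁺ (parentEdge t) (∈-nonRoots⁺ pu ne)) (walkToRoot t fuel _ (<-≤-trans ranks lt) pj)
    walkToRoot t (suc fuel) (inj₂ j) (s≤s lt) pu | no ne =
      let (pi , _ , ranks) = parentB-ok (T t) j pu ne in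
      stepBA (∈-map⁺ (parentEdge t) (∈-nonRoots⁺ pu ne)) (walkToRoot t fuel _ (<-≤-trans ranks lt) pi)

    cover : Cover c k
    cover = record
      { part      = part
      ; colour    = colour
      ; edges     = treeEdges
      ; unique    = λ t → unique-map (parentEdge t) (parentEdge-injective t)
                            (UniqueP.filter⁺ (except (inPart t) _≟V_ (root (T t))) allVertices-unique)
      ; edgesIn   = treeEdges-in
      ; size      = λ t → trans (cong (_+ 1) (length-map (parentEdge t) (nonRoots t)))
                                (length-except (inPart t) _≟V_ (root (T t)) (allVertices a b)
                                   allVertices-unique (∈-allVertices _) (root∈ (T t)))
      ; connected = λ t u v pu pv → walkToRoot t _ u (n<1+n _) pu ++W reverseW (walkToRoot t _ v (n<1+n _) pv)
      }

  cover1 : ∀ {P col} → RootedTree P col → (∀ v → P v) → Cover c 1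
  cover1 {P} {col} T all = TreesToCover.cover (λ _ → zero) (λ _ → col) tree
    where
    tree : ∀ t → RootedTree (λ v → zero ≡ t) col
    tree zero = retarget (λ _ _ → refl) (λ v _ → all v) T

  cover2 : ∀ (Q : Vertex a b → Bool) {col₁ col₂} →
           RootedTree (λ v → Q v ≡ true) col₁ → RootedTree (λ v → Q v ≡ false) col₂ → Cover c 2
  cover2 Q {col₁} {col₂} T₁ T₂ = TreesToCover.cover part colour tree
    where
    part : Vertex a b → Fin 2
    part v = if Q v then zero else suc zero

    colour : Fin 2 → Colour
    colour zero       = col₁
    colour (suc zero) = col₂

    part≡0 : ∀ v → Q v ≡ true → part v ≡ zero
    part≡0 v q rewrite q = refl

    part≡1 : ∀ v → Q v ≡ false → part v ≡ suc zero
    part≡1 v q rewrite q = refl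

    part≡0⁻ : ∀ v → part v ≡ zero → Q v ≡ true
    part≡0⁻ v p with Q v
    ... | true = refl

    part≡1⁻ : ∀ v → part v ≡ suc zero → Q v ≡ false
    part≡1⁻ v p with Q v
    ... | false = refl

    tree : ∀ t → RootedTree (λ v → part v ≡ t) (colour t)
    tree zero       = retarget part≡0 part≡0⁻ T₁
    tree (suc zero) = retarget part≡1 part≡1⁻ T₂

  doubleStar : ∀ {P : Vertex a b → Set} {col} (x : Fin a) → P (inj₁ x) →
               (∀ j → P (inj₂ j) → c x j ≡ col) →
               (hub : Fin a → Fin b) → (∀ i → P (inj₁ i) → i ≢ x → P (inj₂ (hub i)) × c i (hub i) ≡ col) →
               RootedTree P col
  doubleStar {P} {col} x x∈ spoke hub hub-ok = record
    { root = inj₁ x ; root∈ = x∈ ; parentA = hub ; parentB = λ _ → x ; rank = depth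
    ; parentA-ok = leaf ; parentB-ok = λ j pj _ → x∈ , spoke j pj , centre-depth }
    where
    depth : Vertex a b → ℕ
    depth (inj₁ i) = if does (i F.≟ x) then 0 else 2
    depth (inj₂ _) = 1

    centre-depth : depth (inj₁ x) < 1
    centre-depth rewrite dec-true (x F.≟ x) refl = s≤s z≤n

    leaf : ∀ i → P (inj₁ i) → inj₁ i ≢ inj₁ x →
           P (inj₂ (hub i)) × c i (hub i) ≡ col × depth (inj₂ (hub i)) < depth (inj₁ i)
    leaf i pi ne rewrite dec-false (i F.≟ x) (λ i≡x → ne (cong inj₁ i≡x)) =
      let (ph , col) = hub-ok i pi (λ i≡x → ne (cong inj₁ i≡x)) in ph , col , s≤s (s≤s z≤n)

-- The monochromatic component of a vertex r: grown one vertex at a time,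
-- each new vertex attached to an earlier one by an edge of colour col and
-- ranked by its insertion time, until no edge of colour col leaves it.
module Growth {m n} (c : Colouring (suc m) (suc n)) (col : Colour) (r : Vertex (suc m) (suc n)) where
  V : Set
  V = Vertex (suc m) (suc n)

  record Component : Set where
    field
      member  : V → Bool
      tree    : RootedTree c (λ v → member v ≡ true) col
      r∈      : member r ≡ true
      closedA : ∀ i j → member (inj₁ i) ≡ true → c i j ≡ col → member (inj₂ j) ≡ true
      closedB : ∀ i j → member (inj₂ j) ≡ true → c i j ≡ col → member (inj₁ i) ≡ true

  record Stage : Set where
    field
      member     : V → Bool
      tree       : RootedTree c (λ v → member v ≡ true) col
      r∈         : member r ≡ true
      clock      : ℕ
      rank<clock : ∀ v → member v ≡ true → RootedTree.rank tree v < clock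
  open Stage

  _⊑_ : Stage → Stage → Set
  s ⊑ s′ = ∀ v → member s v ≡ true → member s′ v ≡ true

  start : Stage
  start = record
    { member = λ v → does (v ≟V r)
    ; tree = record
        { root = r ; root∈ = dec-true (r ≟V r) refl ; parentA = λ _ → zero ; parentB = λ _ → zero
        ; rank = λ _ → 0
        ; parentA-ok = λ i i∈ i≢r → ⊥-elim (i≢r (only-r i∈))
        ; parentB-ok = λ j j∈ j≢r → ⊥-elim (j≢r (only-r j∈)) }
    ; r∈ = dec-true (r ≟V r) refl
    ; clock = 1
    ; rank<clock = λ _ _ → s≤s z≤n }
    where
    only-r : ∀ {v} → does (v ≟V r) ≡ true → v ≡ r
    only-r {v} v∈ with v ≟V r
    ... | yes v≡r = v≡r

  -- Adding a new vertex w with the current clock as its rank: old parent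
  -- links stay valid, and w may be attached to any old vertex.
  module Add (s : Stage) (w : V) (w∉ : member s w ≡ false) where
    open RootedTree (tree s)

    member′ : V → Bool
    member′ = update _≟V_ w true (member s)

    rank′ : V → ℕ
    rank′ = update _≟V_ w (clock s) rank

    w∈′ : member′ w ≡ true
    w∈′ = update-hit _≟V_ w true (member s)

    old≢w : ∀ {v} → member s v ≡ true → v ≢ w
    old≢w v∈ refl = true≢false (trans (sym v∈) w∉)

    grows : ∀ v → member s v ≡ true → member′ v ≡ true
    grows v v∈ = trans (update-miss _≟V_ true (member s) (old≢w v∈)) v∈

    new-or-old : ∀ v → member′ v ≡ true → v ≡ w ⊎ member s v ≡ true
    new-or-old v v∈′ with v ≟V w
    ... | yes v≡w = inj₁ v≡w
    ... | no _    = inj₂ v∈′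

    rank-kept : ∀ {v} → member s v ≡ true → rank′ v ≡ rank v
    rank-kept v∈ = update-miss _≟V_ (clock s) rank (old≢w v∈)

    keep : ∀ {u v} {X : Set} → member s v ≡ true →
           member s u ≡ true × X × rank u < rank v → member′ u ≡ true × X × rank′ u < rank′ v
    keep v∈ (u∈ , x , lt) rewrite rank-kept u∈ | rank-kept v∈ = grows _ u∈ , x , lt

    attach : ∀ {u} {X : Set} → member s u ≡ true → X → member′ u ≡ true × X × rank′ u < rank′ w
    attach u∈ x rewrite rank-kept u∈ | update-hit _≟V_ w (clock s) rank = grows _ u∈ , x , rank<clock s _ u∈

    rank′<clock : ∀ v → member′ v ≡ true → rank′ v < suc (clock s)
    rank′<clock v v∈′ with new-or-old v v∈′
    ... | inj₁ refl rewrite update-hit _≟V_ w (clock s) rank = n<1+n (clock s)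
    ... | inj₂ v∈ rewrite rank-kept v∈ = <-trans (rank<clock s v v∈) (n<1+n (clock s))

  growA : ∀ (s : Stage) i j → member s (inj₁ i) ≡ false → member s (inj₂ j) ≡ true → c i j ≡ col →
          Σ Stage λ s′ → s ⊑ s′ × member s′ (inj₁ i) ≡ true
  growA s i j i∉ j∈ cij = s′ , grows , w∈′
    where
    open RootedTree (tree s)
    open Add s (inj₁ i) i∉

    parentA′ : Fin (suc m) → Fin (suc n)
    parentA′ = update F._≟_ i j parentA

    ValidA : Fin (suc m) → Fin (suc n) → Set
    ValidA i′ j′ = member′ (inj₂ j′) ≡ true × c i′ j′ ≡ col × rank′ (inj₂ j′) < rank′ (inj₁ i′)

    parentA′-ok : ∀ i′ → member′ (inj₁ i′) ≡ true → inj₁ i′ ≢ root → ValidA i′ (parentA′ i′)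
    parentA′-ok i′ i′∈ i′≢r = by-cases (i′ F.≟ i)
      where
      by-cases : Dec (i′ ≡ i) → ValidA i′ (parentA′ i′)
      by-cases (yes refl) = subst (ValidA i) (sym (update-hit F._≟_ i j parentA)) (attach j∈ cij)
      by-cases (no i′≢i) with new-or-old _ i′∈
      ... | inj₁ i′≡i   = ⊥-elim (i′≢i (inj₁-injective i′≡i))
      ... | inj₂ i′∈old = subst (ValidA i′) (sym (update-miss F._≟_ j parentA i′≢i))
                                (keep i′∈old (parentA-ok i′ i′∈old i′≢r))

    parentB′-ok : ∀ j′ → member′ (inj₂ j′) ≡ true → inj₂ j′ ≢ root →
                  member′ (inj₁ (parentB j′)) ≡ true × c (parentB j′) j′ ≡ col × rank′ (inj₁ (parentB j′)) < rank′ (inj₂ j′)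
    parentB′-ok j′ j′∈ j′≢r with new-or-old _ j′∈
    ... | inj₂ j′∈old = keep j′∈old (parentB-ok j′ j′∈old j′≢r)

    s′ : Stage
    s′ = record
      { member = member′
      ; tree = record { root = root ; root∈ = grows _ root∈ ; parentA = parentA′ ; parentB = parentB ; rank = rank′
                      ; parentA-ok = parentA′-ok ; parentB-ok = parentB′-ok }
      ; r∈ = grows _ (r∈ s) ; clock = suc (clock s) ; rank<clock = rank′<clock }

  growB : ∀ (s : Stage) i j → member s (inj₂ j) ≡ false → member s (inj₁ i) ≡ true → c i j ≡ col →
          Σ Stage λ s′ → s ⊑ s′ × member s′ (inj₂ j) ≡ true
  growB s i j j∉ i∈ cij = s′ , grows , w∈′
    where
    open RootedTree (tree s)
    open Add s (inj₂ j) j∉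

    parentB′ : Fin (suc n) → Fin (suc m)
    parentB′ = update F._≟_ j i parentB

    ValidB : Fin (suc n) → Fin (suc m) → Set
    ValidB j′ i′ = member′ (inj₁ i′) ≡ true × c i′ j′ ≡ col × rank′ (inj₁ i′) < rank′ (inj₂ j′)

    parentB′-ok : ∀ j′ → member′ (inj₂ j′) ≡ true → inj₂ j′ ≢ root → ValidB j′ (parentB′ j′)
    parentB′-ok j′ j′∈ j′≢r = by-cases (j′ F.≟ j)
      where
      by-cases : Dec (j′ ≡ j) → ValidB j′ (parentB′ j′)
      by-cases (yes refl) = subst (ValidB j) (sym (update-hit F._≟_ j i parentB)) (attach i∈ cij)
      by-cases (no j′≢j) with new-or-old _ j′∈
      ... | inj₁ j′≡j   = ⊥-elim (j′≢j (inj₂-injective j′≡j))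
      ... | inj₂ j′∈old = subst (ValidB j′) (sym (update-miss F._≟_ i parentB j′≢j))
                                (keep j′∈old (parentB-ok j′ j′∈old j′≢r))

    parentA′-ok : ∀ i′ → member′ (inj₁ i′) ≡ true → inj₁ i′ ≢ root →
                  member′ (inj₂ (parentA i′)) ≡ true × c i′ (parentA i′) ≡ col × rank′ (inj₂ (parentA i′)) < rank′ (inj₁ i′)
    parentA′-ok i′ i′∈ i′≢r with new-or-old _ i′∈
    ... | inj₂ i′∈old = keep i′∈old (parentA-ok i′ i′∈old i′≢r)

    s′ : Stage
    s′ = record
      { member = member′
      ; tree = record { root = root ; root∈ = grows _ root∈ ; parentA = parentA ; parentB = parentB′ ; rank = rank′
                      ; parentA-ok = parentA′-ok ; parentB-ok = parentB′-ok }
      ; r∈ = grows _ (r∈ s) ; clock = suc (clock s) ; rank<clock = rank′<clock }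

  ExitA ExitB : Stage → Set
  ExitA s = ∃ λ i → member s (inj₁ i) ≡ false × ∃ λ j → member s (inj₂ j) ≡ true × c i j ≡ col
  ExitB s = ∃ λ j → member s (inj₂ j) ≡ false × ∃ λ i → member s (inj₁ i) ≡ true × c i j ≡ col

  exitA? : ∀ s → Dec (ExitA s)
  exitA? s = any? λ i → (member s (inj₁ i) Bool.≟ false) ×-dec
                        any? (λ j → (member s (inj₂ j) Bool.≟ true) ×-dec (c i j ≟C col))

  exitB? : ∀ s → Dec (ExitB s)
  exitB? s = any? λ j → (member s (inj₂ j) Bool.≟ false) ×-dec
                        any? (λ i → (member s (inj₁ i) Bool.≟ true) ×-dec (c i j ≟C col))

  finished : (s : Stage) → ¬ ExitA s → ¬ ExitB s → Component
  finished s noA noB = record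
    { member = member s ; tree = tree s ; r∈ = r∈ s ; closedA = closedA ; closedB = closedB }
    where
    closedA : ∀ i j → member s (inj₁ i) ≡ true → c i j ≡ col → member s (inj₂ j) ≡ true
    closedA i j i∈ cij with member s (inj₂ j) in j∈
    ... | true  = refl
    ... | false = ⊥-elim (noB (j , j∈ , i , i∈ , cij))

    closedB : ∀ i j → member s (inj₂ j) ≡ true → c i j ≡ col → member s (inj₁ i) ≡ true
    closedB i j j∈ cij with member s (inj₁ i) in i∈
    ... | true  = refl
    ... | false = ⊥-elim (noA (i , i∈ , j , j∈ , cij))

  -- Each step strictly lowers the number of outside vertices, which bounds the recursion.
  grow : (fuel : ℕ) (s : Stage) → falses (member s) (allVertices (suc m) (suc n)) ≤ fuel → Component
  grow zero s none = finished s (λ (i , i∉ , _) → true≢false (trans (sym (everything (inj₁ i))) i∉))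
                                (λ (j , j∉ , _) → true≢false (trans (sym (everything (inj₂ j))) j∉))
    where
    everything : ∀ v → member s v ≡ true
    everything v = falses-zero (member s) _ (n≤0⇒n≡0 none) (∈-allVertices v)
  grow (suc fuel) s bound with exitA? s | exitB? s
  ... | yes (i , i∉ , j , j∈ , cij) | _ =
        let (s′ , s⊑s′ , i∈) = growA s i j i∉ j∈ cij
        in grow fuel s′ (≤-pred (≤-trans (falses-strict (member s) (member s′) s⊑s′ _ i∉ i∈ (∈-allVertices _)) bound))
  ... | no _ | yes (j , j∉ , i , i∈ , cij) =
        let (s′ , s⊑s′ , j∈) = growB s i j j∉ i∈ cij
        in grow fuel s′ (≤-pred (≤-trans (falses-strict (member s) (member s′) s⊑s′ _ j∉ j∈ (∈-allVertices _)) bound))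
  ... | no noA | no noB = finished s noA noB

  component : Component
  component = grow _ start ≤-refl

length-filter-map : ∀ {A B : Set} {P : B → Set} (P? : Decidable P) (f : A → B) (xs : List A) →
                    length (filter P? (map f xs)) ≡ length (filter (λ x → P? (f x)) xs)
length-filter-map P? f []       = refl
length-filter-map P? f (x ∷ xs) with does (P? (f x))
... | true  = cong suc (length-filter-map P? f xs)
... | false = length-filter-map P? f xs

length-filter-swap : ∀ {a b} {P : Vertex a b → Set} (P? : Decidable P) →
                     length (filter (λ v → P? (Sum.swap v)) (allVertices b a)) ≡ length (filter P? (allVertices a b))
length-filter-swap {a} {b} {P} P? = begin
  length (filter P?ˢ (map inj₁ (allFin b) ++ map inj₂ (allFin a)))
    ≡⟨ cong length (filter-++ P?ˢ (map inj₁ (allFin b)) (map inj₂ (allFin a))) ⟩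
  length (filter P?ˢ (map inj₁ (allFin b)) ++ filter P?ˢ (map inj₂ (allFin a)))
    ≡⟨ length-++ (filter P?ˢ (map inj₁ (allFin b))) ⟩
  length (filter P?ˢ (map inj₁ (allFin b))) + length (filter P?ˢ (map inj₂ (allFin a)))
    ≡⟨ cong₂ _+_ (length-filter-map P?ˢ inj₁ (allFin b)) (length-filter-map P?ˢ inj₂ (allFin a)) ⟩
  nB + nA
    ≡⟨ +-comm nB nA ⟩
  nA + nB
    ≡⟨ cong₂ _+_ (length-filter-map P? inj₁ (allFin a)) (length-filter-map P? inj₂ (allFin b)) ⟨
  length (filter P? (map inj₁ (allFin a))) + length (filter P? (map inj₂ (allFin b)))
    ≡⟨ length-++ (filter P? (map inj₁ (allFin a))) ⟨
  length (filter P? (map inj₁ (allFin a)) ++ filter P? (map inj₂ (allFin b)))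
    ≡⟨ cong length (filter-++ P? (map inj₁ (allFin a)) (map inj₂ (allFin b))) ⟨
  length (filter P? (map inj₁ (allFin a) ++ map inj₂ (allFin b))) ∎
  where
  open ≡-Reasoning
  P?ˢ : Decidable (λ v → P (Sum.swap v))
  P?ˢ v = P? (Sum.swap v)
  nA nB : ℕ
  nA = length (filter (λ i → P? (inj₁ i)) (allFin a))
  nB = length (filter (λ j → P? (inj₂ j)) (allFin b))

transposeWalk : ∀ {a b} {E : List (Edge a b)} {u v} → Walk E u v →
                Walk (map Prod.swap E) (Sum.swap u) (Sum.swap v)
transposeWalk here         = here
transposeWalk (stepAB e p) = stepBA (∈-map⁺ Prod.swap e) (transposeWalk p)
transposeWalk (stepBA e p) = stepAB (∈-map⁺ Prod.swap e) (transposeWalk p)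

transposeCover : ∀ {a b} {c : Colouring a b} {k} → Cover c k → Cover (transpose c) k
transposeCover {a} {b} {c} {k} C = record
  { part      = λ v → part (Sum.swap v)
  ; colour    = colour
  ; edges     = λ t → map Prod.swap (edges t)
  ; unique    = λ t → UniqueP.map⁺ (cong Prod.swap) (unique t)
  ; edgesIn   = edgesIn′
  ; size      = λ t → trans (cong (_+ 1) (length-map Prod.swap (edges t)))
                            (trans (size t) (sym (length-filter-swap (λ v → part v F.≟ t))))
  ; connected = λ t u v pu pv →
      subst₂ (Walk (map Prod.swap (edges t))) (swap-involutive u) (swap-involutive v)
             (transposeWalk (connected t (Sum.swap u) (Sum.swap v) pu pv))
  }
  where
  open Cover C
  edgesIn′ : ∀ t {j i} → (j , i) ∈ map Prod.swap (edges t) →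
             part (inj₂ j) ≡ t × part (inj₁ i) ≡ t × c i j ≡ colour t
  edgesIn′ t e∈ with ∈-map⁻ Prod.swap e∈
  ... | _ , e∈′ , refl = let (pi , pj , col) = edgesIn t e∈′ in pj , pi , col

subsetOf : ∀ {n} {P : Fin n → Set} → Decidable P → Subset n
subsetOf P? = tabulate (λ j → does (P? j))

∈-subsetOf⁺ : ∀ {n} {P : Fin n → Set} (P? : Decidable P) {j} → P j → j ∈ₛ subsetOf P?
∈-subsetOf⁺ P? {j} pj = lookup⇒[]= j (subsetOf P?) (trans (lookup∘tabulate _ j) (dec-true (P? j) pj))

∈-subsetOf⁻ : ∀ {n} {P : Fin n → Set} (P? : Decidable P) {j} → j ∈ₛ subsetOf P? → P j
∈-subsetOf⁻ P? {j} j∈ with P? j | trans (sym (lookup∘tabulate (λ j → does (P? j)) j)) ([]=⇒lookup j∈)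
... | yes pj | _ = pj

module _ {a b} {c : Colouring a b} {k} (C : Cover c k) where
  open Cover C

  -- A vertex of A that shares its tree with another vertex has a neighbour
  -- in that tree, joined by an edge of the tree's colour: the first edge of
  -- a walk in the tree towards the other vertex.
  tree-neighbour : ∀ i {v} → v ≢ inj₁ i → part v ≡ part (inj₁ i) →
                   ∃ λ j → part (inj₂ j) ≡ part (inj₁ i) × c i j ≡ colour (part (inj₁ i))
  tree-neighbour i v≢i pv with connected (part (inj₁ i)) (inj₁ i) _ refl pv
  ... | here                   = ⊥-elim (v≢i refl)
  ... | stepAB {j = j} e∈ _    = let (_ , pj , col) = edgesIn _ e∈ in j , pj , col

  mono-separated : ∀ {x y} → Fin b → monoA c blue x → monoA c green y → part (inj₁ x) ≢ part (inj₁ y)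
  mono-separated {x} {y} j₀ hx hy px≡py =
    let (j , _ , cxj)   = tree-neighbour x y≢x (sym px≡py)
        (j′ , _ , cyj′) = tree-neighbour y (λ x≡y → y≢x (sym x≡y)) px≡py
    in blue≢green (begin
         blue                   ≡⟨ hx j ⟨
         c x j                  ≡⟨ cxj ⟩
         colour (part (inj₁ x)) ≡⟨ cong colour px≡py ⟩
         colour (part (inj₁ y)) ≡⟨ cyj′ ⟨
         c y j′                 ≡⟨ hy j′ ⟩
         green                  ∎)
    where
    open ≡-Reasoning
    y≢x : inj₁ y ≢ inj₁ x
    y≢x y≡x = blue≢green (trans (sym (hx j₀)) (subst (λ z → c z j₀ ≡ green) (inj₁-injective y≡x) (hy j₀)))

two-elements : ∀ {p q : Fin 2} → p ≢ q → ∀ r → r ≡ p ⊎ r ≡ q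
two-elements {zero}     {zero}     p≢q _          = ⊥-elim (p≢q refl)
two-elements {zero}     {suc zero} _   zero       = inj₁ refl
two-elements {zero}     {suc zero} _   (suc zero) = inj₂ refl
two-elements {suc zero} {zero}     _   zero       = inj₂ refl
two-elements {suc zero} {zero}     _   (suc zero) = inj₁ refl
two-elements {suc zero} {suc zero} p≢q _          = ⊥-elim (p≢q refl)

one-element : (t : Fin 1) → t ≡ zero
one-element zero = refl

module TwoTrees {m n} {c : Colouring (suc m) (suc n)} (C : Cover c 2)
                (x₁ x₂ : Fin (suc m)) (x₁≢x₂ : x₁ ≢ x₂) (hx₁ : monoA c blue x₁) (hx₂ : monoA c blue x₂)
                (y₁ y₂ : Fin (suc m)) (y₁≢y₂ : y₁ ≢ y₂) (hy₁ : monoA c green y₁) (hy₂ : monoA c green y₂) where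
  open Cover C

  tb tg : Fin 2
  tb = part (inj₁ x₁)
  tg = part (inj₁ y₁)

  tb≢tg : tb ≢ tg
  tb≢tg = mono-separated C zero hx₁ hy₁

  x₂∈tb : part (inj₁ x₂) ≡ tb
  x₂∈tb with two-elements tb≢tg (part (inj₁ x₂))
  ... | inj₁ e = e
  ... | inj₂ e = ⊥-elim (mono-separated C zero hx₂ hy₁ e)

  y₂∈tg : part (inj₁ y₂) ≡ tg
  y₂∈tg with two-elements tb≢tg (part (inj₁ y₂))
  ... | inj₁ e = ⊥-elim (mono-separated C zero hx₁ hy₂ (sym e))
  ... | inj₂ e = e

  neighbour : ∀ z w → part (inj₁ w) ≡ part (inj₁ z) → z ≢ w →
              ∃ λ j → part (inj₂ j) ≡ part (inj₁ z) × c z j ≡ colour (part (inj₁ z))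
  neighbour z w pw z≢w = tree-neighbour C z (λ w≡z → z≢w (sym (inj₁-injective w≡z))) pw

  colour-tb : colour tb ≡ blue
  colour-tb = let (j , _ , cj) = neighbour x₁ x₂ x₂∈tb x₁≢x₂ in trans (sym cj) (hx₁ j)

  colour-tg : colour tg ≡ green
  colour-tg = let (j , _ , cj) = neighbour y₁ y₂ y₂∈tg y₁≢y₂ in trans (sym cj) (hy₁ j)

  blue-neighbour : ∀ z → part (inj₁ z) ≡ tb → z ≢ x₁ → ∃ λ j → part (inj₂ j) ≡ tb × c z j ≡ blue
  blue-neighbour z pz z≢x₁ =
    let (j , pj , cj) = neighbour z x₁ (sym pz) z≢x₁
    in j , trans pj pz , trans cj (trans (cong colour pz) colour-tb)

  green-neighbour : ∀ z → part (inj₁ z) ≡ tg → z ≢ y₁ → ∃ λ j → part (inj₂ j) ≡ tg × c z j ≡ green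
  green-neighbour z pz z≢y₁ =
    let (j , pj , cj) = neighbour z y₁ (sym pz) z≢y₁
    in j , trans pj pz , trans cj (trans (cong colour pz) colour-tg)

  -- Both trees meet B, so |B| ≥ 2.
  B-meets-both : ∃ λ jb → ∃ λ jg → part (inj₂ jb) ≡ tb × part (inj₂ jg) ≡ tg
  B-meets-both = let (jb , pb , _) = blue-neighbour x₂ x₂∈tb (λ e → x₁≢x₂ (sym e))
                     (jg , pg , _) = green-neighbour y₂ y₂∈tg (λ e → y₁≢y₂ (sym e))
                 in jb , jg , pb , pg

  not-star : n ≢ 0
  not-star refl = let (jb , jg , pb , pg) = B-meets-both
                  in tb≢tg (trans (sym pb) (trans (cong (λ j → part (inj₂ j)) (trans (one-element jb) (sym (one-element jg)))) pg))

  -- For B' = B ∩ (green tree), the set b(B') is empty: a vertex of b(B')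
  -- lies in one of the two trees and would have, inside that tree, an edge
  -- of the wrong colour.
  not-prime : ¬ (∀ (B' : Subset (suc n)) → Nonempty B' → Proper B' → Σ (Fin (suc m)) (inbB' c B'))
  not-prime witness = no-tree (two-elements tb≢tg (part (inj₁ z)))
    where
    green? : Decidable (λ j → part (inj₂ j) ≡ tg)
    green? j = part (inj₂ j) F.≟ tg

    B' : Subset (suc n)
    B' = subsetOf green?

    nonempty : Nonempty B'
    nonempty = let (_ , jg , _ , pg) = B-meets-both in jg , ∈-subsetOf⁺ green? pg

    outside : ∀ {j} → part (inj₂ j) ≡ tb → j ∉ₛ B'
    outside pj j∈ = tb≢tg (trans (sym pj) (∈-subsetOf⁻ green? j∈))

    proper : Proper B'
    proper = let (jb , _ , pb , _) = B-meets-both in jb , outside pb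

    z : Fin (suc m)
    z = proj₁ (witness B' nonempty proper)

    z∈b : inbB' c B' z
    z∈b = proj₂ (witness B' nonempty proper)

    no-tree : part (inj₁ z) ≡ tb ⊎ part (inj₁ z) ≡ tg → ⊥
    no-tree (inj₁ pz) =
      let (j , pj , cj) = blue-neighbour z pz (λ z≡x₁ → proj₁ z∈b (subst (monoA c blue) (sym z≡x₁) hx₁))
      in blue≢green (trans (sym cj) (proj₂ (proj₂ (proj₂ z∈b) j) (outside pj)))
    no-tree (inj₂ pz) =
      let (j , pj , cj) = green-neighbour z pz (λ z≡y₁ → proj₁ (proj₂ z∈b) (subst (monoA c green) (sym z≡y₁) hy₁))
      in blue≢green (trans (sym (proj₁ (proj₂ (proj₂ z∈b) j) (∈-subsetOf⁺ green? pj))) cj)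

S1A-mono : ∀ {a b} {c : Colouring a b} → S1A c → Σ (Fin a) (monoA c blue) × Σ (Fin a) (monoA c green)
S1A-mono (inj₁ (_ , _ , _ , (x , _ , _ , hx , _) , (y , _ , _ , hy , _)))     = (x , hx) , (y , hy)
S1A-mono (inj₂ (_ , _ , _ , (x , _ , _ , hx , _) , (y , _ , _ , hy , _) , _)) = (x , hx) , (y , hy)

S1A-needs-three : ∀ {m n} {c : Colouring (suc m) (suc n)} → S1A c → ∀ k → Cover c k → 3 ≤ k
S1A-needs-three _ zero C with Cover.part C (inj₁ zero)
... | ()
S1A-needs-three s (suc zero) C =
  let ((_ , hx) , (_ , hy)) = S1A-mono s
  in ⊥-elim (mono-separated C zero hx hy (trans (one-element _) (sym (one-element _))))
S1A-needs-three (inj₁ (_ , _ , b≡1 , (x₁ , x₂ , x₁≢x₂ , hx₁ , hx₂) , (y₁ , y₂ , y₁≢y₂ , hy₁ , hy₂))) (suc (suc zero)) C =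
  ⊥-elim (TwoTrees.not-star C x₁ x₂ x₁≢x₂ hx₁ hx₂ y₁ y₂ y₁≢y₂ hy₁ hy₂ (suc-injective b≡1))
S1A-needs-three (inj₂ (_ , _ , _ , (x₁ , x₂ , x₁≢x₂ , hx₁ , hx₂) , (y₁ , y₂ , y₁≢y₂ , hy₁ , hy₂) , witness)) (suc (suc zero)) C =
  ⊥-elim (TwoTrees.not-prime C x₁ x₂ x₁≢x₂ hx₁ hx₂ y₁ y₂ y₁≢y₂ hy₁ hy₂ witness)
S1A-needs-three _ (suc (suc (suc k))) C = s≤s (s≤s (s≤s z≤n))

module Upper {m n} (c : Colouring (suc m) (suc n)) where
  V : Set
  V = Vertex (suc m) (suc n)

  other-edge-A : ∀ {col i} → ¬ monoA c col i → ∃ λ j → c i j ≡ flip col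
  other-edge-A {col} {i} ¬mono = let (j , cij≢) = ¬∀⟶∃¬ _ _ (λ j → c i j ≟C col) ¬mono in j , other-colour cij≢

  other-edge-B : ∀ {col j} → ¬ monoB c col j → ∃ λ i → c i j ≡ flip col
  other-edge-B {col} {j} ¬mono = let (i , cij≢) = ¬∀⟶∃¬ _ _ (λ i → c i j ≟C col) ¬mono in i , other-colour cij≢

  -- If every vertex has an edge of colour col, then the col-component S of
  -- a vertex of A either spans (one tree), or all edges between S and its
  -- complement have the other colour and (A ∩ S) ∪ (B ∖ S), (A ∖ S) ∪ (B ∩ S)
  -- are spanned by two double stars of that colour.
  module ComponentCover (col : Colour) (edgeA : ∀ i → ∃ λ j → c i j ≡ col)
                        (edgeB : ∀ j → ∃ λ i → c i j ≡ col) where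
    open Growth.Component (Growth.component c col (inj₁ zero))

    same-side : ∀ {i j} → c i j ≡ col → member (inj₁ i) ≡ member (inj₂ j)
    same-side {i} {j} cij with member (inj₁ i) in i∈ | member (inj₂ j) in j∈
    ... | true  | true  = refl
    ... | false | false = refl
    ... | true  | false = ⊥-elim (true≢false (trans (sym (closedA i j i∈ cij)) j∈))
    ... | false | true  = ⊥-elim (true≢false (trans (sym (closedB i j j∈ cij)) i∈))

    crossing : ∀ {i j} → member (inj₁ i) ≢ member (inj₂ j) → c i j ≡ flip col
    crossing differ = other-colour (λ cij → differ (same-side cij))

    split : ∀ i* j* → member (inj₁ i*) ≡ false → member (inj₂ j*) ≡ false → Cover c 2
    split i* j* i*∉ j*∉ = cover2 c Q T₁ T₂
      where
      Q : V → Bool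
      Q (inj₁ i) = member (inj₁ i)
      Q (inj₂ j) = not (member (inj₂ j))

      j₀ : Fin (suc n)
      j₀ = proj₁ (edgeA zero)

      j₀∈ : member (inj₂ j₀) ≡ true
      j₀∈ = closedA zero j₀ r∈ (proj₂ (edgeA zero))

      T₁ : RootedTree c (λ v → Q v ≡ true) (flip col)
      T₁ = doubleStar c zero r∈ (λ j q → crossing (distinct r∈ (not-injective q))) (λ _ → j*)
                      (λ i q _ → cong not j*∉ , crossing (distinct q j*∉))

      T₂ : RootedTree c (λ v → Q v ≡ false) (flip col)
      T₂ = doubleStar c i* i*∉ (λ j q → crossing (distinct′ i*∉ (not-injective q))) (λ _ → j₀)
                      (λ i q _ → cong not j₀∈ , crossing (distinct′ q j₀∈))

    -- An outside vertex has an edge of colour col, whose other end is outside too.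
    outside-pair : (∃ λ i → member (inj₁ i) ≡ false) ⊎ (∃ λ j → member (inj₂ j) ≡ false) → Cover c 2
    outside-pair (inj₁ (i , i∉)) = let (j , cij) = edgeA i in split i j i∉ (trans (sym (same-side cij)) i∉)
    outside-pair (inj₂ (j , j∉)) = let (i , cij) = edgeB j in split i j (trans (same-side cij) j∉) j∉

    result : Cover c 1 ⊎ Cover c 2
    result with any? (λ i → member (inj₁ i) Bool.≟ false) | any? (λ j → member (inj₂ j) Bool.≟ false)
    ... | yes outA | _        = inj₂ (outside-pair (inj₁ outA))
    ... | no _     | yes outB = inj₂ (outside-pair (inj₂ outB))
    ... | no inA   | no inB   = inj₁ (cover1 c tree everything)
      where
      everything : ∀ v → member v ≡ true
      everything (inj₁ i) = ¬-not (λ i∉ → inA (i , i∉))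
      everything (inj₂ j) = ¬-not (λ j∉ → inB (j , j∉))

  monoA? : ∀ col i → Dec (monoA c col i)
  monoA? col i = all? (λ j → c i j ≟C col)

  -- If x is the only col-mono vertex of A and y ∈ A is mono in the other
  -- colour, then {x} and a double star of the other colour centred at y
  -- cover the graph.
  lone-mono-cover : ∀ col x y → monoA c col x → monoA c (flip col) y →
                    (∀ i → i ≢ x → ¬ monoA c col i) → Cover c 2
  lone-mono-cover col x y hx hy only = cover2 c Q T₁ T₂
    where
    Q : V → Bool
    Q (inj₁ i) = not (does (i F.≟ x))
    Q (inj₂ _) = true

    y≢x : y ≢ x
    y≢x refl = flip-≢ col (trans (sym (hx zero)) (hy zero))

    hub : Fin (suc m) → Fin (suc n)
    hub i = choose (λ j → c i j ≟C flip col)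

    T₁ : RootedTree c (λ v → Q v ≡ true) (flip col)
    T₁ = doubleStar c y (cong not (dec-false (y F.≟ x) y≢x)) (λ j _ → hy j) hub
           (λ i q _ → refl , choose-spec (λ j → c i j ≟C flip col) (other-edge-A (only i (does-false (i F.≟ x) (not-injective q)))))

    T₂ : RootedTree c (λ v → Q v ≡ false) col
    T₂ = doubleStar c x (cong not (dec-true (x F.≟ x) refl)) (λ j ()) (λ _ → zero)
           (λ i q i≢x → ⊥-elim (i≢x (does-true (i F.≟ x) (not-injective q))))

  -- If x ∈ A is blue-mono, y ∈ A is green-mono and b(B') is empty for a
  -- nonempty proper B' ⊂ B, then B ∖ B' with the A-vertices having a blue
  -- edge to it is a blue double star centred at x, and the remaining
  -- vertices form a green double star centred at y.
  missing-type-cover : ∀ x y → monoA c blue x → monoA c green y →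
                       (B' : Subset (suc n)) → Nonempty B' → Proper B' → ¬ Σ (Fin (suc m)) (inbB' c B') → Cover c 2
  missing-type-cover x y hx hy B' (j₁ , j₁∈) (j₂ , j₂∉) no-witness = cover2 c Q T₁ T₂
    where
    BlueOut GreenIn : Fin (suc m) → Set
    BlueOut i = ∃ λ j → j ∉ₛ B' × c i j ≡ blue
    GreenIn i = ∃ λ j → j ∈ₛ B' × c i j ≡ green

    blueOut? : ∀ i j → Dec (j ∉ₛ B' × c i j ≡ blue)
    blueOut? i j = ¬? (j ∈? B') ×-dec (c i j ≟C blue)

    greenIn? : ∀ i j → Dec (j ∈ₛ B' × c i j ≡ green)
    greenIn? i j = (j ∈? B') ×-dec (c i j ≟C green)

    Q : V → Bool
    Q (inj₁ i) = does (any? (blueOut? i))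
    Q (inj₂ j) = not (does (j ∈? B'))

    -- An A-vertex with no blue edge to B ∖ B' has a green edge into B', since otherwise it would lie in b(B').
    green-in : ∀ i → ¬ BlueOut i → GreenIn i
    green-in i ¬out with any? (greenIn? i)
    ... | yes g   = g
    ... | no ¬in = ⊥-elim (no-witness (i , (λ mono → ¬out (j₂ , j₂∉ , mono j₂)) , (λ mono → ¬in (j₁ , j₁∈ , mono j₁)) ,
                                        λ j → (λ j∈ → other-colour (λ cij → ¬in (j , j∈ , cij))) ,
                                              (λ j∉ → other-colour (λ cij → ¬out (j , j∉ , cij)))))

    T₁ : RootedTree c (λ v → Q v ≡ true) blue
    T₁ = doubleStar c x (dec-true (any? (blueOut? x)) (j₂ , j₂∉ , hx j₂)) (λ j _ → hx j) (λ i → choose (blueOut? i))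
           (λ i q _ → let (j∉ , cij) = choose-spec (blueOut? i) (does-true (any? (blueOut? i)) q)
                      in cong not (dec-false (_ ∈? B') j∉) , cij)

    T₂ : RootedTree c (λ v → Q v ≡ false) green
    T₂ = doubleStar c y (dec-false (any? (blueOut? y)) (λ (j , _ , cyj) → blue≢green (trans (sym cyj) (hy j))))
           (λ j _ → hy j) (λ i → choose (greenIn? i))
           (λ i q _ → let (j∈ , cij) = choose-spec (greenIn? i) (green-in i (does-false (any? (blueOut? i)) q))
                      in cong not (dec-true (_ ∈? B') j∈) , cij)

  inbB'? : ∀ B' i → Dec (inbB' c B' i)
  inbB'? B' i = ¬? (monoA? blue i) ×-dec (¬? (monoA? green i) ×-dec
                all? (λ j → ((j ∈? B') →-dec (c i j ≟C blue)) ×-dec (¬? (j ∈? B') →-dec (c i j ≟C green))))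

  module NoTwoTrees (x y : Fin (suc m)) (hx : monoA c blue x) (hy : monoA c green y) (no2 : ¬ Cover c 2) where

    s-type : SType c
    s-type = inj₁ (x , hx) , inj₁ (y , hy)

    -- A B-vertex sees both x and y, so it is mono in neither colour.
    XY⊆A-holds : XY⊆A c
    XY⊆A-holds j = (λ mono → blue≢green (trans (sym (mono y)) (hy j))) ,
                   (λ mono → blue≢green (trans (sym (hx j)) (mono x)))

    two-blue : atLeastTwo (monoA c blue)
    two-blue with any? (λ i → ¬? (i F.≟ x) ×-dec monoA? blue i)
    ... | yes (x′ , x′≢x , hx′) = x′ , x , x′≢x , hx′ , hx
    ... | no ¬x′ = ⊥-elim (no2 (lone-mono-cover blue x y hx hy (λ i i≢x mono → ¬x′ (i , i≢x , mono))))

    two-green : atLeastTwo (monoA c green)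
    two-green with any? (λ i → ¬? (i F.≟ y) ×-dec monoA? green i)
    ... | yes (y′ , y′≢y , hy′) = y′ , y , y′≢y , hy′ , hy
    ... | no ¬y′ = ⊥-elim (no2 (lone-mono-cover green y x hy hx (λ i i≢y mono → ¬y′ (i , i≢y , mono))))

    every-type : ∀ (B' : Subset (suc n)) → Nonempty B' → Proper B' → Σ (Fin (suc m)) (inbB' c B')
    every-type B' nonempty proper with any? (inbB'? B')
    ... | yes w = w
    ... | no ¬w = ⊥-elim (no2 (missing-type-cover x y hx hy B' nonempty proper ¬w))

    result : S1A c
    result with n Nat.≟ 0
    ... | yes n≡0 = inj₁ (s-type , XY⊆A-holds , cong suc n≡0 , two-blue , two-green)
    ... | no n≢0  = inj₂ (s-type , XY⊆A-holds , s≤s (n≢0⇒n>0 n≢0) , two-blue , two-green , every-type)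

  monoB? : ∀ col j → Dec (monoB c col j)
  monoB? col j = all? (λ i → c i j ≟C col)

  HasMono : Colour → Set
  HasMono col = Σ (Fin (suc m)) (monoA c col) ⊎ Σ (Fin (suc n)) (monoB c col)

  hasMono? : ∀ col → Dec (HasMono col)
  hasMono? col = any? (monoA? col) ⊎-dec any? (monoB? col)

  -- Without col-mono vertices every vertex has an edge of the other colour,
  -- and the component construction yields at most two trees.
  few-trees-without-mono : ∀ col → ¬ HasMono col → Cover c 1 ⊎ Cover c 2
  few-trees-without-mono col none =
    ComponentCover.result (flip col) (λ i → other-edge-A (λ mono → none (inj₁ (i , mono))))
                                     (λ j → other-edge-B (λ mono → none (inj₂ (j , mono))))

too-few-trees : ∀ {a b} (c : Colouring a b) → (∀ k → Cover c k → 3 ≤ k) → ¬ (Cover c 1 ⊎ Cover c 2)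
too-few-trees c three (inj₁ C) with three 1 C
... | s≤s ()
too-few-trees c three (inj₂ C) with three 2 C
... | s≤s (s≤s ())

S1-from-needs-three : ∀ {m n} (c : Colouring (suc m) (suc n)) → (∀ k → Cover c k → 3 ≤ k) → S1 c
S1-from-needs-three c three = classify (hasMono? blue) (hasMono? green)
  where
  open Upper c

  fewer : ¬ (Cover c 1 ⊎ Cover c 2)
  fewer = too-few-trees c three

  -- X ∪ Y lies within one side: a blue-mono and a green-mono vertex on
  -- opposite sides would share an edge of both colours.
  classify : Dec (HasMono blue) → Dec (HasMono green) → S1 c
  classify (no ¬X) _       = ⊥-elim (fewer (few-trees-without-mono blue ¬X))
  classify (yes _) (no ¬Y) = ⊥-elim (fewer (few-trees-without-mono green ¬Y))
  classify (yes (inj₁ (x , hx))) (yes (inj₁ (y , hy))) =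
    inj₁ (NoTwoTrees.result x y hx hy (λ C → fewer (inj₂ C)))
  classify (yes (inj₂ (x , hx))) (yes (inj₂ (y , hy))) =
    inj₂ (Upper.NoTwoTrees.result (transpose c) x y hx hy (λ C → fewer (inj₂ (transposeCover C))))
  classify (yes (inj₁ (x , hx))) (yes (inj₂ (y , hy))) = ⊥-elim (blue≢green (trans (sym (hx y)) (hy x)))
  classify (yes (inj₂ (x , hx))) (yes (inj₁ (y , hy))) = ⊥-elim (blue≢green (trans (sym (hx y)) (hy x)))

lemma4 : ∀ {m n} (c : Colouring (suc m) (suc n)) →
    S1 c ⇔ (∀ k → Cover c k → 3 ≤ k)
lemma4 c = mk⇔ needs-three (S1-from-needs-three c)
  where
  needs-three : S1 c → ∀ k → Cover c k → 3 ≤ k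
  needs-three (inj₁ s) k C = S1A-needs-three s k C
  needs-three (inj₂ s) k C = S1A-needs-three s k (transposeCover C)
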